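{- Let $k\geq 2$ and $1\leq x\leq 2k-1$ be integers, $n=2k+x$, and consider a $p$-labeled packing of $k$ copies of $C_n$ into $K_n$. Let $q$ be the minimum, over the $p$ labels, of the number of vertices of $C_n$ carrying that label. Then there exists a set of at least $2k$ vertices of $C_n$ whose labels, taken together, number at most $2q$ distinct labels.
   Context: $C_n$ is the cycle on $n$ vertices and $K_n$ the complete graph on $n$ vertices. A $p$-labeled packing of $k$ copies of $C_n$ into $K_n$ is a map $f$ from $V(K_n)$ onto a set of exactly $p$ labels together with injections $\sigma_1,\dots,\sigma_k:V(C_n)\to V(K_n)$ such that for $i\neq j$ the induced edge images $\sigma_i^*(E(C_n))$ and $\sigma_j^*(E(C_n))$ are disjoint, and for every $v\in V(C_n)$, $f(\sigma_1(v))=\dots=f(\sigma_k(v))$. Since both graphs have $n$ vertices the $\sigma_i$ are bijections, and each vertex $v$ of $C_n$ is assigned the well-defined label $f(\sigma_1(v))$; in particular the number of vertices of $C_n$ with a given label equals the number of vertices of $K_n$ with that label. -}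

module Defs where

open import Data.Nat using (ℕ; zero; suc; _+_; _*_; _≤_; _<_)
open import Data.Fin using (Fin; toℕ)
open import Data.Fin.Subset using (Subset; _∈_; ∣_∣)
open import Data.List using (List; length; filter)
open import Data.List using () renaming (_∷_ to _∷ₗ_)
open import Data.Fin using (_≟_)
open import Data.Fin.Base using () 
open import Data.List.Base using ()
open import Data.Product using (Σ; ∃; _×_; _,_)
open import Data.Sum using (_⊎_)
open import Data.Empty using (⊥)
open import Relation.Nullary using (¬_)
open import Relation.Binary.PropositionalEquality using (_≡_; _≢_)
open import Function.Definitions using (Injective; Surjective)

open import Data.List.Base using () renaming (allFin to allFinL)

-- The cycle C_n on vertex set Fin n: vertex u is joined to u+1 (mod n).
-- Each edge {u, u+1 mod n} is listed (in this directed form) once.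
CycleEdge : (n : ℕ) → Fin n → Fin n → Set
CycleEdge n u v = (suc (toℕ u) ≡ toℕ v) ⊎ ((suc (toℕ u) ≡ n) × (toℕ v ≡ 0))

SameEdge : {n : ℕ} → Fin n → Fin n → Fin n → Fin n → Set
SameEdge a b c d = ((a ≡ c) × (b ≡ d)) ⊎ ((a ≡ d) × (b ≡ c))

-- A p-labeled packing of k copies of C_n into K_n (vertices of K_n are Fin n,
-- labels are Fin p, copies are indexed by Fin k).
record LabeledPacking (n p k : ℕ) : Set where
  field
    label   : Fin n → Fin p
    label-onto : Surjective _≡_ _≡_ label
    σ       : Fin k → Fin n → Fin n
    σ-inj   : ∀ i → Injective _≡_ _≡_ (σ i)
    disjoint : ∀ i j → i ≢ j → ∀ u v w z → CycleEdge n u v → CycleEdge n w z →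
               ¬ SameEdge (σ i u) (σ i v) (σ j w) (σ j z)
    compatible : ∀ i j (v : Fin n) → label (σ i v) ≡ label (σ j v)

open LabeledPacking public

-- The label of vertex v of C_n, computed through copy i (independent of i
-- by compatibility).
vlabel : ∀ {n p k} → LabeledPacking n p k → Fin k → Fin n → Fin p
vlabel P i v = label P (σ P i v)

labelCount : ∀ {n p k} → LabeledPacking n p k → Fin k → Fin p → ℕ
labelCount {n} P i l = length (filter (λ v → vlabel P i v ≟ l) (allFinL n))

module Submission where

open import Defs
open import Data.Nat using (ℕ; _+_; _*_; _∸_; _≤_; _<_)
open import Data.Fin using (Fin)
open import Data.Fin.Subset using (Subset; _∈_; ∣_∣)
open import Data.Product using (Σ; ∃; _×_; _,_)
open import Relation.Binary.PropositionalEquality using (_≡_)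

open import Data.Nat using (zero; suc; z≤n; s≤s; _<?_)
open import Data.Nat.Properties
  using (≤-trans; ≤-reflexive; ≤-<-trans; ≮⇒≥; ≤-antisym; +-suc; +-identityʳ; +-mono-≤; +-monoʳ-≤; n≤1+n; m≤m+n; 1+n≰n; module ≤-Reasoning)
open import Data.Fin as Fin using (toℕ; fromℕ; fromℕ<; inject₁; punchOut; remQuot; _≟_)
open import Data.Fin.Properties
  using (any?; 0≢1+n; suc-injective; toℕ-fromℕ<; toℕ-fromℕ; toℕ-inject₁; toℕ<n; punchOut-injective; injective⇒≤; *↔×)
open import Data.Fin.Subset using (inside; outside; ⁅_⁆; _∪_; ⊥; _-_)
open import Data.Fin.Subset.Properties
  using (∉⊥; x∈⁅x⁆; x∈⁅y⁆⇒x≡y; x∈p∪q⁺; x∈p∪q⁻; ∣⁅x⁆∣≡1; ∣⊥∣≡0; x∈p∧x≢y⇒x∈p-y; x∈p⇒∣p-x∣<∣p∣)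
open import Data.Vec using ([]; _∷_)
open import Data.List using (List; length; map; filter; allFin; _++_) renaming ([] to []ₗ; _∷_ to _∷ₗ_)
open import Data.List.Properties using (length-++; length-map)
open import Data.List.Relation.Unary.Any using (here; there)
open import Data.List.Membership.Propositional using () renaming (_∈_ to _∈ₗ_)
open import Data.List.Membership.Propositional.Properties using (∈-map⁺; ∈-map⁻; ∈-++⁺ˡ; ∈-++⁺ʳ; ∈-filter⁺; ∈-allFin)
open import Data.Product using (proj₁; proj₂)
open import Data.Sum using (_⊎_; inj₁; inj₂; [_,_])
open import Relation.Nullary using (yes; no; contradiction)
open import Relation.Binary.PropositionalEquality using (_≢_; refl; sym; trans; cong; cong₂; subst)
open import Function using (_∘_)
open import Function.Bundles using (Injection)
open import Function.Definitions using (Injective; StrictlySurjective)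
open import Function.Consequences.Propositional using (surjective⇒strictlySurjective)
open import Function.Properties.Inverse using (↔⇒↣)

-- Pick a hub a, a vertex of K_n carrying the label l that is attained q times. In copy j, a is
-- the image of a centre w_j in C_n, which therefore also carries l, and the two cycle-neighbours
-- of w_j are sent to two neighbours of a, the spokes of copy j. Because the copies are
-- edge-disjoint and n ≥ 3, all 2k spokes are distinct; pulled back along one copy they form S.
-- Each spoke has the label of a cycle-neighbour of some vertex labelled l, and the q vertices
-- labelled l have at most 2q cycle-neighbours.

∣p∪q∣≤∣p∣+∣q∣ : ∀ {n} (p q : Subset n) → ∣ p ∪ q ∣ ≤ ∣ p ∣ + ∣ q ∣
∣p∪q∣≤∣p∣+∣q∣ []            []            = z≤n
∣p∪q∣≤∣p∣+∣q∣ (outside ∷ p) (outside ∷ q) = ∣p∪q∣≤∣p∣+∣q∣ p q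
∣p∪q∣≤∣p∣+∣q∣ (outside ∷ p) (inside  ∷ q) =
  ≤-trans (s≤s (∣p∪q∣≤∣p∣+∣q∣ p q)) (≤-reflexive (sym (+-suc ∣ p ∣ ∣ q ∣)))
∣p∪q∣≤∣p∣+∣q∣ (inside  ∷ p) (outside ∷ q) = s≤s (∣p∪q∣≤∣p∣+∣q∣ p q)
∣p∪q∣≤∣p∣+∣q∣ (inside  ∷ p) (inside  ∷ q) =
  s≤s (≤-trans (∣p∪q∣≤∣p∣+∣q∣ p q) (+-monoʳ-≤ ∣ p ∣ (n≤1+n ∣ q ∣)))

fromList : ∀ {n} → List (Fin n) → Subset n
fromList []ₗ       = ⊥
fromList (x ∷ₗ xs) = ⁅ x ⁆ ∪ fromList xs

∈-fromList⁺ : ∀ {n} {x : Fin n} {xs} → x ∈ₗ xs → x ∈ fromList xs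
∈-fromList⁺ (here refl)  = x∈p∪q⁺ (inj₁ (x∈⁅x⁆ _))
∈-fromList⁺ (there x∈xs) = x∈p∪q⁺ (inj₂ (∈-fromList⁺ x∈xs))

∈-fromList⁻ : ∀ {n} {x : Fin n} xs → x ∈ fromList xs → x ∈ₗ xs
∈-fromList⁻ []ₗ       x∈⊥ = contradiction x∈⊥ ∉⊥
∈-fromList⁻ (y ∷ₗ ys) x∈  =
  [ here ∘ x∈⁅y⁆⇒x≡y y , there ∘ ∈-fromList⁻ ys ] (x∈p∪q⁻ ⁅ y ⁆ (fromList ys) x∈)

∣fromList∣≤length : ∀ {n} (xs : List (Fin n)) → ∣ fromList xs ∣ ≤ length xs
∣fromList∣≤length {n} []ₗ = ≤-reflexive (∣⊥∣≡0 n)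
∣fromList∣≤length (x ∷ₗ xs) =
  ≤-trans (∣p∪q∣≤∣p∣+∣q∣ ⁅ x ⁆ (fromList xs))
          (+-mono-≤ (≤-reflexive (∣⁅x⁆∣≡1 x)) (∣fromList∣≤length xs))

image : ∀ {m n} → (Fin m → Fin n) → Subset n
image {m} g = fromList (map g (allFin m))

∈-image⁺ : ∀ {m n} (g : Fin m → Fin n) t → g t ∈ image g
∈-image⁺ g t = ∈-fromList⁺ (∈-map⁺ g (∈-allFin t))

∈-image⁻ : ∀ {m n} (g : Fin m → Fin n) {v} → v ∈ image g → ∃ λ t → v ≡ g t
∈-image⁻ {m} g v∈ with t , _ , v≡gt ← ∈-map⁻ g (∈-fromList⁻ (map g (allFin m)) v∈) = t , v≡gt

injective⇒≤∣p∣ : ∀ {m n} {g : Fin m → Fin n} (p : Subset n) →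
                 Injective _≡_ _≡_ g → (∀ t → g t ∈ p) → m ≤ ∣ p ∣
injective⇒≤∣p∣ {zero}          p g-inj g∈p = z≤n
injective⇒≤∣p∣ {suc m} {g = g} p g-inj g∈p =
  ≤-<-trans (injective⇒≤∣p∣ (p - g Fin.zero) (suc-injective ∘ g-inj) g∘suc∈p-g0)
            (x∈p⇒∣p-x∣<∣p∣ (g∈p Fin.zero))
  where
  g∘suc∈p-g0 : ∀ t → g (Fin.suc t) ∈ p - g Fin.zero
  g∘suc∈p-g0 t = x∈p∧x≢y⇒x∈p-y (g∈p (Fin.suc t)) (λ eq → 0≢1+n (g-inj (sym eq)))

injective⇒strictlySurjective : ∀ {n} {f : Fin n → Fin n} →
                               Injective _≡_ _≡_ f → StrictlySurjective _≡_ f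
injective⇒strictlySurjective {suc n} {f} f-inj y with any? (λ x → f x ≟ y)
... | yes hit = hit
... | no miss = contradiction (injective⇒≤ g-inj) 1+n≰n
  where
  y≢f : ∀ x → y ≢ f x
  y≢f x eq = miss (x , sym eq)
  g : Fin (suc n) → Fin n
  g x = punchOut (y≢f x)
  g-inj : Injective _≡_ _≡_ g
  g-inj eq = f-inj (punchOut-injective (y≢f _) (y≢f _) eq)

next : ∀ {n} → Fin n → Fin n
next {suc m} w with suc (toℕ w) <? suc m
... | yes w+1<n = fromℕ< w+1<n
... | no _      = Fin.zero

next-edge : ∀ {n} (w : Fin n) → CycleEdge n w (next w)
next-edge {suc m} w with suc (toℕ w) <? suc m
... | yes w+1<n = inj₁ (sym (toℕ-fromℕ< w+1<n))
... | no  w+1≮n = inj₂ (≤-antisym (toℕ<n w) (≮⇒≥ w+1≮n) , refl)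

prev : ∀ {n} → Fin n → Fin n
prev {suc m} Fin.zero    = fromℕ m
prev         (Fin.suc w) = inject₁ w

prev-edge : ∀ {n} (w : Fin n) → CycleEdge n (prev w) w
prev-edge {suc m} Fin.zero    = inj₂ (cong suc (toℕ-fromℕ m) , refl)
prev-edge         (Fin.suc w) = inj₁ (cong suc (toℕ-inject₁ w))

Adjacent : (n : ℕ) → Fin n → Fin n → Set
Adjacent n w x = CycleEdge n w x ⊎ CycleEdge n x w

neighbour : ∀ {n} → Fin 2 → Fin n → Fin n
neighbour Fin.zero           = next
neighbour (Fin.suc Fin.zero) = prev

neighbour-adjacent : ∀ {n} e (w : Fin n) → Adjacent n w (neighbour e w)
neighbour-adjacent Fin.zero           w = inj₁ (next-edge w)
neighbour-adjacent (Fin.suc Fin.zero) w = inj₂ (prev-edge w)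

cycleEdge-bothWays⇒n≤2 : ∀ {n} {u v : Fin n} → CycleEdge n u v → CycleEdge n v u → n ≤ 2
cycleEdge-bothWays⇒n≤2 = twoCycle
  where
  twoCycle : ∀ {n a b} → (suc a ≡ b) ⊎ ((suc a ≡ n) × (b ≡ 0)) →
             (suc b ≡ a) ⊎ ((suc b ≡ n) × (a ≡ 0)) → n ≤ 2
  twoCycle (inj₁ refl)          (inj₁ ())
  twoCycle (inj₁ refl)          (inj₂ (refl , refl)) = s≤s (s≤s z≤n)
  twoCycle (inj₂ (refl , refl)) (inj₁ refl)          = s≤s (s≤s z≤n)
  twoCycle (inj₂ (refl , refl)) (inj₂ (_ , refl))    = s≤s z≤n

next≢prev : ∀ {n} → 3 ≤ n → (w : Fin n) → next w ≢ prev w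
next≢prev 3≤n w eq = 1+n≰n (≤-trans 3≤n
  (cycleEdge-bothWays⇒n≤2 (next-edge w) (subst (λ v → CycleEdge _ v w) (sym eq) (prev-edge w))))

neighbour-injective : ∀ {n} → 3 ≤ n → (w : Fin n) → ∀ e e' → neighbour e w ≡ neighbour e' w → e ≡ e'
neighbour-injective _   w Fin.zero           Fin.zero           _  = refl
neighbour-injective 3≤n w Fin.zero           (Fin.suc Fin.zero) eq = contradiction eq (next≢prev 3≤n w)
neighbour-injective 3≤n w (Fin.suc Fin.zero) Fin.zero           eq = contradiction (sym eq) (next≢prev 3≤n w)
neighbour-injective _   w (Fin.suc Fin.zero) (Fin.suc Fin.zero) _  = refl

labelled : ∀ {n p} → (Fin n → Fin p) → Fin p → List (Fin n)
labelled {n} c l = filter (λ v → c v ≟ l) (allFin n)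

neighbourLabels : ∀ {n p} → (Fin n → Fin p) → Fin p → Subset p
neighbourLabels c l = fromList (map (c ∘ next) (labelled c l) ++ map (c ∘ prev) (labelled c l))

∣neighbourLabels∣≤2*count : ∀ {n p} (c : Fin n → Fin p) l →
                            ∣ neighbourLabels c l ∣ ≤ 2 * length (labelled c l)
∣neighbourLabels∣≤2*count {n} {p} c l = begin
  ∣ neighbourLabels c l ∣      ≤⟨ ∣fromList∣≤length (nexts ++ prevs) ⟩
  length (nexts ++ prevs)     ≡⟨ length-++ nexts ⟩
  length nexts + length prevs ≡⟨ cong₂ _+_ (length-map (c ∘ next) xs) (length-map (c ∘ prev) xs) ⟩
  length xs + length xs       ≡⟨ cong (length xs +_) (sym (+-identityʳ (length xs))) ⟩
  2 * length xs               ∎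
  where
  open ≤-Reasoning
  xs : List (Fin n)
  xs = labelled c l
  nexts prevs : List (Fin p)
  nexts = map (c ∘ next) xs
  prevs = map (c ∘ prev) xs

neighbour-label∈ : ∀ {n p} (c : Fin n → Fin p) {l w} → c w ≡ l → ∀ e →
                   c (neighbour e w) ∈ neighbourLabels c l
neighbour-label∈ c {l} {w} cw≡l e = ∈-fromList⁺ (inLists e)
  where
  w∈ : w ∈ₗ labelled c l
  w∈ = ∈-filter⁺ (λ v → c v ≟ l) (∈-allFin w) cw≡l
  inLists : ∀ e → c (neighbour e w) ∈ₗ map (c ∘ next) (labelled c l) ++ map (c ∘ prev) (labelled c l)
  inLists Fin.zero           = ∈-++⁺ˡ (∈-map⁺ (c ∘ next) w∈)
  inLists (Fin.suc Fin.zero) = ∈-++⁺ʳ _ (∈-map⁺ (c ∘ prev) w∈)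

copies-edge-disjoint : ∀ {n p k} (P : LabeledPacking n p k) {j j'} → j ≢ j' →
                       ∀ {w x w' x'} → Adjacent n w x → Adjacent n w' x' →
                       σ P j w ≡ σ P j' w' → σ P j x ≢ σ P j' x'
copies-edge-disjoint P j≢j' (inj₁ wx) (inj₁ w'x') ww' xx' =
  disjoint P _ _ j≢j' _ _ _ _ wx w'x' (inj₁ (ww' , xx'))
copies-edge-disjoint P j≢j' (inj₁ wx) (inj₂ x'w') ww' xx' =
  disjoint P _ _ j≢j' _ _ _ _ wx x'w' (inj₂ (ww' , xx'))
copies-edge-disjoint P j≢j' (inj₂ xw) (inj₁ w'x') ww' xx' =
  disjoint P _ _ j≢j' _ _ _ _ xw w'x' (inj₂ (xx' , ww'))
copies-edge-disjoint P j≢j' (inj₂ xw) (inj₂ x'w') ww' xx' =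
  disjoint P _ _ j≢j' _ _ _ _ xw x'w' (inj₁ (xx' , ww'))

module Spokes {n p k} (3≤n : 3 ≤ n) (P : LabeledPacking n p k) (i : Fin k) (l : Fin p) where

  hub : Fin n
  hub = proj₁ (surjective⇒strictlySurjective (label-onto P) l)

  hub-label : label P hub ≡ l
  hub-label = proj₂ (surjective⇒strictlySurjective (label-onto P) l)

  σ⁻¹ : Fin k → Fin n → Fin n
  σ⁻¹ j b = proj₁ (injective⇒strictlySurjective (σ-inj P j) b)

  σ∘σ⁻¹ : ∀ j b → σ P j (σ⁻¹ j b) ≡ b
  σ∘σ⁻¹ j b = proj₂ (injective⇒strictlySurjective (σ-inj P j) b)

  σ⁻¹-injective : ∀ j → Injective _≡_ _≡_ (σ⁻¹ j)
  σ⁻¹-injective j {b} {b'} eq = trans (sym (σ∘σ⁻¹ j b)) (trans (cong (σ P j) eq) (σ∘σ⁻¹ j b'))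

  centre : Fin k → Fin n
  centre j = σ⁻¹ j hub

  centre-label : ∀ j → vlabel P i (centre j) ≡ l
  centre-label j = trans (compatible P i j (centre j)) (trans (cong (label P) (σ∘σ⁻¹ j hub)) hub-label)

  spoke : Fin 2 × Fin k → Fin n
  spoke (e , j) = σ P j (neighbour e (centre j))

  spoke-injective : Injective _≡_ _≡_ spoke
  spoke-injective {e , j} {e' , j'} eq with j ≟ j'
  ... | yes refl = cong (_, j) (neighbour-injective 3≤n (centre j) e e' (σ-inj P j eq))
  ... | no j≢j'  = contradiction eq (copies-edge-disjoint P j≢j'
          (neighbour-adjacent e (centre j)) (neighbour-adjacent e' (centre j'))
          (trans (σ∘σ⁻¹ j hub) (sym (σ∘σ⁻¹ j' hub))))

  spoke-label : ∀ s → label P (spoke s) ∈ neighbourLabels (vlabel P i) l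
  spoke-label (e , j) = subst (_∈ neighbourLabels (vlabel P i) l)
    (compatible P i j (neighbour e (centre j))) (neighbour-label∈ (vlabel P i) (centre-label j) e)

  vertex : Fin (2 * k) → Fin n
  vertex = σ⁻¹ i ∘ spoke ∘ remQuot k

  vertex-injective : Injective _≡_ _≡_ vertex
  vertex-injective = Injection.injective (↔⇒↣ *↔×) ∘ spoke-injective ∘ σ⁻¹-injective i

  vertex-label : ∀ t → vlabel P i (vertex t) ∈ neighbourLabels (vlabel P i) l
  vertex-label t = subst (_∈ neighbourLabels (vlabel P i) l)
    (cong (label P) (sym (σ∘σ⁻¹ i (spoke (remQuot k t))))) (spoke-label (remQuot k t))

largeSet-fewLabels : ∀ {n p k} → 3 ≤ n → (P : LabeledPacking n p k) (i : Fin k) (l : Fin p) →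
  Σ (Subset n) λ S → (2 * k ≤ ∣ S ∣) ×
    Σ (Subset p) λ L → (∣ L ∣ ≤ 2 * labelCount P i l) × (∀ v → v ∈ S → vlabel P i v ∈ L)
largeSet-fewLabels 3≤n P i l =
  image vertex , injective⇒≤∣p∣ (image vertex) vertex-injective (∈-image⁺ vertex) ,
  neighbourLabels (vlabel P i) l , ∣neighbourLabels∣≤2*count (vlabel P i) l , labels-covered
  where
  open Spokes 3≤n P i l
  labels-covered : ∀ v → v ∈ image vertex → vlabel P i v ∈ neighbourLabels (vlabel P i) l
  labels-covered v v∈ with t , refl ← ∈-image⁻ vertex v∈ = vertex-label t

mainTheorem2 : (k x : ℕ) → 2 ≤ k → 1 ≤ x → x ≤ 2 * k ∸ 1 →
    (p : ℕ) (P : LabeledPacking (2 * k + x) p k) (i : Fin k) →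
    (q : ℕ) → (∃ λ l → labelCount P i l ≡ q) → (∀ l → q ≤ labelCount P i l) →
    Σ (Subset (2 * k + x)) λ S → (2 * k ≤ ∣ S ∣) ×
      Σ (Subset p) λ L → (∣ L ∣ ≤ 2 * q) × (∀ v → v ∈ S → vlabel P i v ∈ L)
mainTheorem2 k x 2≤k 1≤x _ p P i _ (l , refl) _ = largeSet-fewLabels 3≤n P i l
  where
  3≤n : 3 ≤ 2 * k + x
  3≤n = +-mono-≤ (≤-trans 2≤k (m≤m+n k (k + 0))) 1≤x
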